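{- Let $n\ge 3$ and let $F$ be a minimal set of faulty edges of $Q_n$ such that some proper vertex subset $T$ of $Q_n$ is disconnected halfway with respect to $F$, and no proper subset of $T$ is disconnected halfway with respect to the same $F$. Then: (1) If $|T|=4$, then $T$ is a 2-dimensional subcube (a 4-cycle) disconnected halfway, i.e. a $Q_2$-DHW trap. (2) If $|T|=6$, then the subgraph induced by $T$ contains a cycle of length 6. (3) If $|T|=8$, then the subgraph induced by $T$ contains a cycle of length 8, or $Q_n-F$ contains a CL trap.
   Context: $Q_n$ is the $n$-dimensional hypercube: vertices are binary strings of length $n$, adjacent iff they differ in exactly one bit. The parity of a vertex is the parity of the number of ones in its label. A set of vertices is identified with the subgraph of $Q_n$ it induces; $|T|_0,|T|_1$ denote the numbers of vertices of $T$ of parity 0 and 1. $F$ is a set of faulty edges; the cube is Hamiltonian if $Q_n-F$ has a Hamiltonian cycle. $F$ is minimal if $Q_n-F$ is not Hamiltonian but $Q_n-F'$ is Hamiltonian for every proper subset $F'\subsetneq F$. A proper vertex subset $T$ is disconnected halfway (w.r.t. $F$) if either $|T|_0\ge|T|_1$ and all edges joining parity-0 vertices of $T$ to vertices outside $T$ lie in $F$, or $|T|_1\ge|T|_0$ and all edges joining parity-1 vertices of $T$ to vertices outside $T$ lie in $F$. A $Q_2$-DHW trap is a set $T$ forming a 2-dimensional subcube (4-cycle $(u,v,w,x)$) that is disconnected halfway. A CL (claw) trap consists of three healthy edges $(u,v),(u,w),(u,x)$ (not in $F$) such that each of $v,w,x$ has degree exactly 2 in $Q_n-F$. -}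

module Defs where

open import Data.Bool using (Bool; true; false; not; _xor_; if_then_else_)
open import Data.Nat using (ℕ; zero; suc; _+_; _≤_; _^_)
open import Data.Fin using (Fin)
open import Data.Vec using (Vec; []; _∷_; lookup)
open import Data.List using (List; []; _∷_; _++_; [_]; length; filter; map)
open import Data.List.Relation.Unary.Linked using (Linked)
open import Data.List.Relation.Unary.All using (All)
open import Data.List.Relation.Unary.Unique.Propositional using (Unique)
open import Data.List.Membership.Propositional using (_∈_)
open import Data.Product using (Σ; ∃; ∃-syntax; _×_; _,_)
open import Data.Sum using (_⊎_)
open import Data.Empty using (⊥)
open import Relation.Nullary using (¬_)
open import Relation.Binary.PropositionalEquality using (_≡_; _≢_)
open import Function using (_⇔_)

V : ℕ → Set
V n = Vec Bool n

allV : (n : ℕ) → List (V n)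
allV zero = [] ∷ []
allV (suc n) = map (false ∷_) (allV n) ++ map (true ∷_) (allV n)

count : ∀ {n} → (V n → Bool) → ℕ
count {n} P = length (filter (λ v → P v Data.Bool.≟ true) (allV n))

hamming : ∀ {n} → V n → V n → ℕ
hamming [] [] = zero
hamming (a ∷ u) (b ∷ v) = (if a xor b then 1 else 0) + hamming u v

Adj : ∀ {n} → V n → V n → Set
Adj u v = hamming u v ≡ 1

-- parity of the number of ones (false = parity 0, true = parity 1)
parity : ∀ {n} → V n → Bool
parity [] = false
parity (a ∷ v) = a xor parity v

record EdgeSet (n : ℕ) : Set where
  field
    mem   : V n → V n → Bool
    sym   : ∀ u v → mem u v ≡ mem v u
    edges : ∀ u v → mem u v ≡ true → Adj u v
open EdgeSet public

_⊂E_ : ∀ {n} → EdgeSet n → EdgeSet n → Set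
F' ⊂E F = (∀ u v → mem F' u v ≡ true → mem F u v ≡ true)
        × (∃[ u ] ∃[ v ] (mem F u v ≡ true × mem F' u v ≡ false))

Healthy : ∀ {n} → EdgeSet n → V n → V n → Set
Healthy F u v = Adj u v × mem F u v ≡ false

ClosedWalk : ∀ {A : Set} → (A → A → Set) → List A → Set
ClosedWalk E [] = ⊥
ClosedWalk E (x ∷ xs) = Linked E (x ∷ xs ++ [ x ])

IsCycle : ∀ {A : Set} → (A → A → Set) → List A → Set
IsCycle E c = Unique c × 3 ≤ length c × ClosedWalk E c

Hamiltonian : ∀ {n} → EdgeSet n → Set
Hamiltonian {n} F = ∃[ c ] (IsCycle (Healthy F) c × (∀ (v : V n) → v ∈ c))

Minimal : ∀ {n} → EdgeSet n → Set
Minimal {n} F = ¬ Hamiltonian F × (∀ (F' : EdgeSet n) → F' ⊂E F → Hamiltonian F')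

VSet : ℕ → Set
VSet n = V n → Bool

size : ∀ {n} → VSet n → ℕ
size T = count T

size0 : ∀ {n} → VSet n → ℕ
size0 T = count (λ v → T v Data.Bool.∧ not (parity v))

size1 : ∀ {n} → VSet n → ℕ
size1 T = count (λ v → T v Data.Bool.∧ parity v)

ProperNonempty : ∀ {n} → VSet n → Set
ProperNonempty T = (∃[ v ] T v ≡ true) × (∃[ v ] T v ≡ false)

_⊂V_ : ∀ {n} → VSet n → VSet n → Set
S ⊂V T = (∃[ v ] S v ≡ true) × (∀ v → S v ≡ true → T v ≡ true)
       × (∃[ v ] (T v ≡ true × S v ≡ false))

CutOff : ∀ {n} → EdgeSet n → VSet n → Bool → Set
CutOff F T p = ∀ u v → T u ≡ true → parity u ≡ p → T v ≡ false → Adj u v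
             → mem F u v ≡ true

DHW : ∀ {n} → EdgeSet n → VSet n → Set
DHW F T = ProperNonempty T
        × ((size1 T ≤ size0 T × CutOff F T false)
           ⊎ (size0 T ≤ size1 T × CutOff F T true))

IsQ2 : ∀ {n} → VSet n → Set
IsQ2 {n} T = ∃[ i ] ∃[ j ] ∃[ w ] (i ≢ j ×
  (∀ v → (T v ≡ true) ⇔ (∀ (k : Fin n) → k ≢ i → k ≢ j → lookup v k ≡ lookup w k)))

Q2DHWTrap : ∀ {n} → EdgeSet n → VSet n → Set
Q2DHWTrap F T = IsQ2 T × DHW F T

InducedCycle : ∀ {n} → VSet n → ℕ → Set
InducedCycle T k = ∃[ c ] (IsCycle Adj c × length c ≡ k × All (λ v → T v ≡ true) c)

degree : ∀ {n} → EdgeSet n → V n → ℕ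
degree F u = count (λ v → (if hamming u v Data.Nat.≡ᵇ 1 then true else false)
                           Data.Bool.∧ not (mem F u v))

CLTrap : ∀ {n} → EdgeSet n → Set
CLTrap F = ∃[ u ] ∃[ v ] ∃[ w ] ∃[ x ]
  (v ≢ w × v ≢ x × w ≢ x
  × Healthy F u v × Healthy F u w × Healthy F u x
  × degree F v ≡ 2 × degree F w ≡ 2 × degree F x ≡ 2)

-- Let p be the parity on which T is cut off, A the parity-p vertices of T, B the others, and H
-- the bipartite graph of healthy A–B edges. For nonempty X ⊆ A the set X ∪ N_H(X) is again cut
-- off on parity p, so if |N_H(X)| ≤ |X| it is disconnected halfway and minimality of T forces
-- X ∪ N_H(X) = T: H satisfies a strict Hall condition. Dropping one vertex of A shows
-- |A| = |B| = h, and a search through all h × h bipartite graphs shows that a strict-Hall graph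
-- is K₂,₂ (h = 2), has a Hamiltonian cycle (h = 3), or has a Hamiltonian cycle or a vertex of B
-- with three neighbours of degree 2 (h = 4). A vertex of A has all its healthy edges in H, so the
-- latter is a claw trap of Q_n − F; and a 4-cycle of Q_n spans a 2-dimensional subcube.
module Submission where

open import Defs hiding (sym)
open import Data.Bool using (Bool; true; false; not; _∧_; _∨_; if_then_else_)
import Data.Bool as Bool
open import Data.Bool.ListAction using (any)
open import Data.Bool.Properties
  using (T-∧; T-∨; T-≡; T-not-≡; not-involutive; not-¬; ¬-not; ∧-identityʳ; ∧-conicalˡ; ∧-conicalʳ)
open import Data.Empty using (⊥; ⊥-elim)
open import Data.Fin using (Fin; zero; suc)
import Data.Fin as Fin
open import Data.Fin.Properties using (all?; any?; _≟_)
open import Data.List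
  using (List; []; _∷_; _++_; [_]; length; filter; map; allFin; concatMap; cartesianProductWith)
import Data.List as List
open import Data.List.Membership.Propositional using (_∈_; find)
open import Data.List.Membership.Propositional.Properties
  using (∈-∃++; ∈-++⁻; ∈-++⁺ˡ; ∈-++⁺ʳ; ∈-filter⁺; ∈-filter⁻; ∈-lookup; ∈-allFin; ∈-map⁺; ∈-map⁻)
open import Data.List.Properties using (length-++; length-map; map-++; filter-all; length-tabulate)
open import Data.List.Relation.Unary.All as All using (All; lookupAny)
import Data.List.Relation.Unary.All.Properties as All
open import Data.List.Relation.Unary.Any as Any using (Any; here; there)
open import Data.List.Relation.Unary.Any.Properties using (any⁻; any⁺; lookup-index)
open import Data.List.Relation.Unary.Linked as Linked using (Linked; linked?)
import Data.List.Relation.Unary.Linked.Properties as Linked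
open import Data.List.Relation.Unary.Unique.Propositional using (Unique; []; _∷_)
import Data.List.Relation.Unary.Unique.Propositional.Properties as Unique
import Data.List.Relation.Unary.Unique.DecPropositional as DecUnique
open import Data.Nat using (ℕ; zero; suc; _+_; _≤_; _≤ᵇ_; _≡ᵇ_; z≤n; s≤s; ⌊_/2⌋)
import Data.Nat.Properties as ℕ
open import Data.Product using (∃-syntax; _×_; _,_; proj₁; proj₂)
import Data.Product as Product
open import Data.Sum using (_⊎_; inj₁; inj₂; [_,_]′)
import Data.Sum as Sum
open import Data.Sum.Properties using () renaming (≡-dec to ≡-dec-⊎)
open import Data.Vec using (Vec; []; _∷_; lookup; updateAt; tabulate)
open import Data.Vec.Properties
  using (∷-injective; lookup∘tabulate; updateAt-updateAt; updateAt-cong; updateAt-id; lookup∘updateAt; lookup∘updateAt′;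
         tabulate∘lookup; tabulate-cong)
import Data.Vec.Properties as Vec
open import Function using (_⇔_; mk⇔; Equivalence; _∘_; id)
import Function.Properties.Equivalence as ⇔
open import Relation.Binary using (Decidable; DecidableEquality)
open import Relation.Nullary using (Dec; yes; no; ¬_; ¬?; does; contradiction; _×-dec_; _⊎-dec_)
open import Relation.Nullary.Decidable using (⌊_⌋; True; toWitness; dec-true; dec-false)
open import Relation.Binary.PropositionalEquality
  using (_≡_; _≢_; refl; sym; trans; cong; cong₂; subst; subst₂)

open Equivalence using (to; from)

unique-⊆⇒length≤ : {X : Set} {xs ys : List X} → Unique xs → (∀ {x} → x ∈ xs → x ∈ ys) → length xs ≤ length ys
unique-⊆⇒length≤ {xs = []} _ _ = z≤n
unique-⊆⇒length≤ {xs = x ∷ xs} (x∉xs ∷ xs!) xs⊆ys with ∈-∃++ (xs⊆ys (here refl))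
... | us , vs , refl = subst (suc (length xs) ≤_) length-us++x∷vs
    (s≤s (unique-⊆⇒length≤ xs! xs⊆us++vs))
  where
  length-us++x∷vs : suc (length (us ++ vs)) ≡ length (us ++ x ∷ vs)
  length-us++x∷vs = trans (cong suc (length-++ us)) (sym (trans (length-++ us) (ℕ.+-suc (length us) (length vs))))
  xs⊆us++vs : ∀ {y} → y ∈ xs → y ∈ us ++ vs
  xs⊆us++vs {y} y∈xs with ∈-++⁻ us (xs⊆ys (there y∈xs))
  ... | inj₁ y∈us = ∈-++⁺ˡ y∈us
  ... | inj₂ (here refl) = ⊥-elim (All.lookup x∉xs y∈xs refl)
  ... | inj₂ (there y∈vs) = ∈-++⁺ʳ us y∈vs

length-filter-split : {X : Set} (P Q : X → Bool) (xs : List X) →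
  length (filter (λ x → P x Bool.≟ true) xs)
    ≡ length (filter (λ x → P x ∧ Q x Bool.≟ true) xs) + length (filter (λ x → P x ∧ not (Q x) Bool.≟ true) xs)
length-filter-split P Q [] = refl
length-filter-split P Q (x ∷ xs) with P x | Q x
... | false | _     = length-filter-split P Q xs
... | true  | true  = cong suc (length-filter-split P Q xs)
... | true  | false = trans (cong suc (length-filter-split P Q xs)) (sym (ℕ.+-suc _ _))

lookup-injective : {X : Set} {xs : List X} → Unique xs → ∀ {i j} → List.lookup xs i ≡ List.lookup xs j → i ≡ j
lookup-injective (_    ∷ _)   {zero}  {zero}  _  = refl
lookup-injective (x∉xs ∷ _)   {zero}  {suc j} x≡ = ⊥-elim (All.lookup x∉xs (∈-lookup j) x≡)
lookup-injective (x∉xs ∷ _)   {suc i} {zero}  ≡x = ⊥-elim (All.lookup x∉xs (∈-lookup i) (sym ≡x))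
lookup-injective (_    ∷ xs!) {suc i} {suc j} e  = cong suc (lookup-injective xs! e)

record Enumeration {X : Set} (P : X → Bool) (m : ℕ) : Set where
  field
    element           : Fin m → X
    element-injective : ∀ {i j} → element i ≡ element j → i ≡ j
    element-sound     : ∀ i → P (element i) ≡ true
    element-complete  : ∀ {x} → P x ≡ true → ∃[ i ] element i ≡ x

module Counting {X : Set} (U : List X) (U-unique : Unique U) (U-complete : ∀ x → x ∈ U) where

  members : (X → Bool) → List X
  members P = filter (λ x → P x Bool.≟ true) U

  card : (X → Bool) → ℕ
  card P = length (members P)

  members-unique : ∀ P → Unique (members P)
  members-unique P = Unique.filter⁺ _ U-unique

  ∈-members⁺ : ∀ P {x} → P x ≡ true → x ∈ members P
  ∈-members⁺ P {x} = ∈-filter⁺ _ (U-complete x)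

  ∈-members⁻ : ∀ P {x} → x ∈ members P → P x ≡ true
  ∈-members⁻ P x∈ = proj₂ (∈-filter⁻ (λ x → P x Bool.≟ true) {xs = U} x∈)

  card≤length : ∀ P {L : List X} → (∀ {x} → P x ≡ true → x ∈ L) → card P ≤ length L
  card≤length P P⊆L = unique-⊆⇒length≤ (members-unique P) (λ x∈ → P⊆L (∈-members⁻ P x∈))

  length≤card : ∀ P {L : List X} → Unique L → (∀ {x} → x ∈ L → P x ≡ true) → length L ≤ card P
  length≤card P L! L⊆P = unique-⊆⇒length≤ L! (λ x∈ → ∈-members⁺ P (L⊆P x∈))

  card-split : ∀ P Q → card P ≡ card (λ x → P x ∧ Q x) + card (λ x → P x ∧ not (Q x))
  card-split P Q = length-filter-split P Q U

  enumerate : ∀ P → Enumeration P (card P)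
  enumerate P = record
    { element           = List.lookup (members P)
    ; element-injective = lookup-injective (members-unique P)
    ; element-sound     = λ i → ∈-members⁻ P (∈-lookup i)
    ; element-complete  = λ Px → let x∈ = ∈-members⁺ P Px in Any.index x∈ , sym (lookup-index x∈)
    }

module IndexCount (m : ℕ) = Counting (allFin m) (Unique.allFin⁺ m) ∈-allFin

#_ : ∀ {m} → (Fin m → Bool) → ℕ
#_ {m} = IndexCount.card m

card-reindex : ∀ {X : Set} {U : List X} (U-unique : Unique U) (U-complete : ∀ x → x ∈ U)
  {k} (f : Fin k → X) → (∀ {i j} → f i ≡ f j → i ≡ j)
  → (P : X → Bool) (Q : Fin k → Bool) → (∀ j → P (f j) ≡ Q j) → (∀ {x} → P x ≡ true → ∃[ j ] f j ≡ x)
  → Counting.card U U-unique U-complete P ≡ # Q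
card-reindex U! U-complete {k} f f-injective P Q P∘f≡Q P⊆f =
  ℕ.≤-antisym (subst (card P ≤_) (length-map f members-Q) (card≤length P P⊆fQ))
              (subst (_≤ card P) (length-map f members-Q)
                     (length≤card P (Unique.map⁺ f-injective (IndexCount.members-unique k Q)) fQ⊆P))
  where
  open Counting _ U! U-complete
  members-Q : List (Fin k)
  members-Q = IndexCount.members k Q
  P⊆fQ : ∀ {x} → P x ≡ true → x ∈ map f members-Q
  P⊆fQ Px with j , refl ← P⊆f Px = ∈-map⁺ f (IndexCount.∈-members⁺ k Q (trans (sym (P∘f≡Q j)) Px))
  fQ⊆P : ∀ {x} → x ∈ map f members-Q → P x ≡ true
  fQ⊆P x∈ with j , j∈ , refl ← ∈-map⁻ f x∈ = trans (P∘f≡Q j) (IndexCount.∈-members⁻ k Q j∈)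

allV-complete : ∀ n (v : V n) → v ∈ allV n
allV-complete zero    []          = here refl
allV-complete (suc n) (false ∷ v) = ∈-++⁺ˡ (∈-map⁺ (false ∷_) (allV-complete n v))
allV-complete (suc n) (true ∷ v)  = ∈-++⁺ʳ (map (false ∷_) (allV n)) (∈-map⁺ (true ∷_) (allV-complete n v))

allV-unique : ∀ n → Unique (allV n)
allV-unique zero    = All.[] ∷ []
allV-unique (suc n) = Unique.++⁺ (Unique.map⁺ ∷-injectiveʳ (allV-unique n)) (Unique.map⁺ ∷-injectiveʳ (allV-unique n)) disjoint
  where
  ∷-injectiveʳ : ∀ {b : Bool} {u v : V n} → b ∷ u ≡ b ∷ v → u ≡ v
  ∷-injectiveʳ e = proj₂ (∷-injective e)
  disjoint : ∀ {v} → ¬ (v ∈ map (false ∷_) (allV n) × v ∈ map (true ∷_) (allV n))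
  disjoint (v∈₀ , v∈₁) with ∈-map⁻ (false ∷_) v∈₀ | ∈-map⁻ (true ∷_) v∈₁
  ... | _ , _ , refl | _ , _ , ()

module VertexCount (n : ℕ) = Counting (allV n) (allV-unique n) (allV-complete n)

hamming-sym : ∀ {n} (u v : V n) → hamming u v ≡ hamming v u
hamming-sym []          []          = refl
hamming-sym (false ∷ u) (false ∷ v) = hamming-sym u v
hamming-sym (false ∷ u) (true ∷ v)  = cong suc (hamming-sym u v)
hamming-sym (true ∷ u)  (false ∷ v) = cong suc (hamming-sym u v)
hamming-sym (true ∷ u)  (true ∷ v)  = hamming-sym u v

hamming≡0⇒≡ : ∀ {n} {u v : V n} → hamming u v ≡ 0 → u ≡ v
hamming≡0⇒≡ {u = []}        {[]}        _ = refl
hamming≡0⇒≡ {u = false ∷ u} {false ∷ v} e = cong (false ∷_) (hamming≡0⇒≡ e)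
hamming≡0⇒≡ {u = true ∷ u}  {true ∷ v}  e = cong (true ∷_) (hamming≡0⇒≡ e)

Adj-sym : ∀ {n} {u v : V n} → Adj u v → Adj v u
Adj-sym {u = u} {v} uv = trans (hamming-sym v u) uv

Adj⇒parity≢ : ∀ {n} {u v : V n} → Adj u v → parity u ≡ not (parity v)
Adj⇒parity≢ {u = []}        {[]}        ()
Adj⇒parity≢ {u = false ∷ u} {false ∷ v} e = Adj⇒parity≢ {u = u} e
Adj⇒parity≢ {u = true ∷ u}  {true ∷ v}  e = cong not (Adj⇒parity≢ {u = u} e)
Adj⇒parity≢ {u = false ∷ u} {true ∷ v}  e =
  trans (cong parity (hamming≡0⇒≡ {u = u} {v} (ℕ.suc-injective e))) (sym (not-involutive _))
Adj⇒parity≢ {u = true ∷ u}  {false ∷ v} e = cong (not ∘ parity) (hamming≡0⇒≡ {u = u} {v} (ℕ.suc-injective e))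

-- For p = false, true, withParity p S is by definition the predicate counted by size0 S, size1 S.
hasParity : ∀ {n} → Bool → V n → Bool
hasParity p v = if p then parity v else not (parity v)

hasParity⁺ : ∀ {n} {p} {v : V n} → parity v ≡ p → hasParity p v ≡ true
hasParity⁺ {p = false} e rewrite e = refl
hasParity⁺ {p = true}  e = e

hasParity⁻ : ∀ {n} {p} {v : V n} → hasParity p v ≡ true → parity v ≡ p
hasParity⁻ {p = false} e = T-not-≡ .to (T-≡ .from e)
hasParity⁻ {p = true}  e = e

withParity : ∀ {n} → Bool → VSet n → VSet n
withParity p S v = S v ∧ hasParity p v

size-split : ∀ {n} p (S : VSet n) → size S ≡ count (withParity p S) + count (withParity (not p) S)
size-split true  S = VertexCount.card-split _ S parity
size-split false S = trans (VertexCount.card-split _ S parity) (ℕ.+-comm (size1 S) (size0 S))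

-- Two-dimensional subcubes

flip : ∀ {n} → V n → Fin n → V n
flip v i = updateAt v i not

flip-involutive : ∀ {n} (v : V n) i → flip (flip v i) i ≡ v
flip-involutive v i = trans (updateAt-updateAt i v) (trans (updateAt-cong i not-involutive v) (updateAt-id i v))

lookup-flip : ∀ {n} (v : V n) i → lookup (flip v i) i ≡ not (lookup v i)
lookup-flip v i = lookup∘updateAt i v

lookup-flip-≢ : ∀ {n} (v : V n) {i k} → k ≢ i → lookup (flip v i) k ≡ lookup v k
lookup-flip-≢ v {i} {k} k≢i = lookup∘updateAt′ k i k≢i v

lookup-ext : ∀ {n} {u v : V n} → (∀ k → lookup u k ≡ lookup v k) → u ≡ v
lookup-ext {u = u} {v} u≗v = trans (sym (tabulate∘lookup u)) (trans (tabulate-cong u≗v) (tabulate∘lookup v))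

Adj⇒flip : ∀ {n} {u v : V n} → Adj u v → ∃[ i ] v ≡ flip u i
Adj⇒flip {u = []}        {[]}        ()
Adj⇒flip {u = false ∷ u} {true ∷ v}  e = zero , cong (true ∷_) (sym (hamming≡0⇒≡ {u = u} (ℕ.suc-injective e)))
Adj⇒flip {u = true ∷ u}  {false ∷ v} e = zero , cong (false ∷_) (sym (hamming≡0⇒≡ {u = u} (ℕ.suc-injective e)))
Adj⇒flip {u = false ∷ u} {false ∷ v} e with i , v≡ ← Adj⇒flip {u = u} e = suc i , cong (false ∷_) v≡
Adj⇒flip {u = true ∷ u}  {true ∷ v}  e with i , v≡ ← Adj⇒flip {u = u} e = suc i , cong (true ∷_) v≡

AgreeOutside : ∀ {n} → Fin n → Fin n → V n → V n → Set
AgreeOutside {n} i j v w = ∀ (k : Fin n) → k ≢ i → k ≢ j → lookup v k ≡ lookup w k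

agreeOutside⇒≡ : ∀ {n} {i j : Fin n} {v w : V n} → AgreeOutside i j v w
  → lookup v i ≡ lookup w i → lookup v j ≡ lookup w j → v ≡ w
agreeOutside⇒≡ {i = i} {j} {v} {w} vw vᵢ vⱼ = lookup-ext agreeAt
  where
  agreeAt : ∀ k → lookup v k ≡ lookup w k
  agreeAt k with k ≟ i | k ≟ j
  ... | yes refl | _        = vᵢ
  ... | no _     | yes refl = vⱼ
  ... | no k≢i   | no k≢j   = vw k k≢i k≢j

SquareCorner : ∀ {n} → V n → Fin n → Fin n → V n → Set
SquareCorner a i j v = v ≡ a ⊎ v ≡ flip a i ⊎ v ≡ flip a j ⊎ v ≡ flip (flip a i) j

agreeOutside⇔squareCorner : ∀ {n} {a v : V n} {i j} → i ≢ j → AgreeOutside i j v a ⇔ SquareCorner a i j v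
agreeOutside⇔squareCorner {a = a} {v} {i} {j} i≢j = mk⇔ corner agrees
  where
  j≢i : j ≢ i
  j≢i = i≢j ∘ sym
  agrees : ∀ {v} → SquareCorner a i j v → AgreeOutside i j v a
  agrees (inj₁ refl)               _ _   _   = refl
  agrees (inj₂ (inj₁ refl))        _ k≢i _   = lookup-flip-≢ a k≢i
  agrees (inj₂ (inj₂ (inj₁ refl))) _ _   k≢j = lookup-flip-≢ a k≢j
  agrees (inj₂ (inj₂ (inj₂ refl))) _ k≢i k≢j = trans (lookup-flip-≢ (flip a i) k≢j) (lookup-flip-≢ a k≢i)
  ≡corner : ∀ {c} → SquareCorner a i j c → AgreeOutside i j v a
    → lookup v i ≡ lookup c i → lookup v j ≡ lookup c j → v ≡ c
  ≡corner c va vᵢ vⱼ = agreeOutside⇒≡ (λ k k≢i k≢j → trans (va k k≢i k≢j) (sym (agrees c k k≢i k≢j))) vᵢ vⱼ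
  corner : AgreeOutside i j v a → SquareCorner a i j v
  corner va with lookup v i Bool.≟ lookup a i | lookup v j Bool.≟ lookup a j
  ... | yes vᵢ | yes vⱼ = inj₁ (≡corner (inj₁ refl) va vᵢ vⱼ)
  ... | no vᵢ  | yes vⱼ = inj₂ (inj₁ (≡corner (inj₂ (inj₁ refl)) va
        (trans (¬-not vᵢ) (sym (lookup-flip a i))) (trans vⱼ (sym (lookup-flip-≢ a j≢i)))))
  ... | yes vᵢ | no vⱼ  = inj₂ (inj₂ (inj₁ (≡corner (inj₂ (inj₂ (inj₁ refl))) va
        (trans vᵢ (sym (lookup-flip-≢ a i≢j))) (trans (¬-not vⱼ) (sym (lookup-flip a j))))))
  ... | no vᵢ  | no vⱼ  = inj₂ (inj₂ (inj₂ (≡corner (inj₂ (inj₂ (inj₂ refl))) va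
        (trans (¬-not vᵢ) (sym (trans (lookup-flip-≢ (flip a i) i≢j) (lookup-flip a i))))
        (trans (¬-not vⱼ) (sym (trans (lookup-flip (flip a i) j) (cong not (lookup-flip-≢ a j≢i))))))))

fourth-corner : ∀ {n} {a a′ : V n} {i j} → i ≢ j → a′ ≢ a
  → Adj (flip a i) a′ → Adj (flip a j) a′ → a′ ≡ flip (flip a i) j
fourth-corner {a = a} {a′} {i} {j} i≢j a′≢a ba′ b′a′ with k , refl ← Adj⇒flip {u = flip a i} {a′} ba′ with k ≟ j
... | yes refl = refl
... | no k≢j with l , a′≡ ← Adj⇒flip {u = flip a j} {flip (flip a i) k} b′a′ with l ≟ j
...   | yes refl = contradiction (trans a′≡ (flip-involutive a j)) a′≢a
...   | no l≢j = contradiction (trans (sym a′ⱼ≡aⱼ) a′ⱼ≡¬aⱼ) (not-¬ refl)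
  where
  a′ⱼ≡aⱼ : lookup (flip (flip a i) k) j ≡ lookup a j
  a′ⱼ≡aⱼ = trans (lookup-flip-≢ (flip a i) (k≢j ∘ sym)) (lookup-flip-≢ a (i≢j ∘ sym))
  a′ⱼ≡¬aⱼ : lookup (flip (flip a i) k) j ≡ not (lookup a j)
  a′ⱼ≡¬aⱼ = trans (cong (λ w → lookup w j) a′≡) (trans (lookup-flip-≢ (flip a j) (l≢j ∘ sym)) (lookup-flip a j))

four-cycle⇒IsQ2 : ∀ {n} (T : VSet n) {a b a′ b′ : V n} → b ≢ b′ → a′ ≢ a
  → Adj a b → Adj a b′ → Adj b a′ → Adj b′ a′
  → (∀ v → (T v ≡ true) ⇔ (v ≡ a ⊎ v ≡ b ⊎ v ≡ b′ ⊎ v ≡ a′))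
  → IsQ2 T
four-cycle⇒IsQ2 T {a} {b} {a′} {b′} b≢b′ a′≢a ab ab′ ba′ b′a′ T≡corners
  with i , refl ← Adj⇒flip {u = a} {b} ab with j , refl ← Adj⇒flip {u = a} {b′} ab′ with i ≟ j
... | yes refl = contradiction refl b≢b′
... | no i≢j with refl ← fourth-corner i≢j a′≢a ba′ b′a′ =
  i , j , a , i≢j , λ v → ⇔.trans (T≡corners v) (⇔.sym (agreeOutside⇔squareCorner i≢j))

-- Bipartite graphs and the strict Hall condition

Graph : ℕ → ℕ → Set
Graph m m′ = Vec (Vec Bool m′) m

edge : ∀ {m m′} → Graph m m′ → Fin m → Fin m′ → Bool
edge G i j = lookup (lookup G i) j

neighbourhood : ∀ {m m′} → Graph m m′ → (Fin m → Bool) → Fin m′ → Bool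
neighbourhood {m} G X j = any (λ i → X i ∧ edge G i j) (allFin m)

∈-neighbourhood : ∀ {m m′} (G : Graph m m′) {X i j} → X i ≡ true → edge G i j ≡ true → neighbourhood G X j ≡ true
∈-neighbourhood G {X} {i} {j} Xi Gij =
  T-≡ .to (any⁺ (λ i → X i ∧ edge G i j) (Any.map (λ { refl → T-∧ .from (T-≡ .from Xi , T-≡ .from Gij) }) (∈-allFin i)))

record HallViolator {m m′} (G : Graph m m′) (X : Fin m → Bool) : Set where
  field
    inhabited : ∃[ i ] X i ≡ true
    proper    : (∃[ i ] X i ≡ false) ⊎ (∃[ j ] neighbourhood G X j ≡ false)
    deficient : # neighbourhood G X ≤ # X

StrictHall : ∀ {m m′} → Graph m m′ → Set
StrictHall G = ∀ X → ¬ HallViolator G X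

isHallViolator : ∀ {m m′} → Graph m m′ → (Fin m → Bool) → Bool
isHallViolator {m} {m′} G X =
  any X (allFin m) ∧ (any (not ∘ X) (allFin m) ∨ any (not ∘ N) (allFin m′)) ∧ (# N ≤ᵇ # X)
  where
  N : Fin m′ → Bool
  N = neighbourhood G X

any-allFin⁻ : ∀ {k} (f : Fin k → Bool) → Bool.T (any f (allFin k)) → ∃[ i ] Bool.T (f i)
any-allFin⁻ f t with i , _ , fi ← find (any⁻ f (allFin _) t) = i , fi

isHallViolator-sound : ∀ {m m′} (G : Graph m m′) X → Bool.T (isHallViolator G X) → HallViolator G X
isHallViolator-sound G X t with inh , rest ← T-∧ .to t with prp , small ← T-∧ .to rest = record
  { inhabited = let i , Xi = any-allFin⁻ X inh in i , T-≡ .to Xi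
  ; proper    = [ (λ t → let i , ¬Xi = any-allFin⁻ _ t in inj₁ (i , T-not-≡ .to ¬Xi))
                , (λ t → let j , ¬Nj = any-allFin⁻ _ t in inj₂ (j , T-not-≡ .to ¬Nj)) ]′ (T-∨ .to prp)
  ; deficient = ℕ.≤ᵇ⇒≤ _ _ small
  }

allVec : {A : Set} → ((A → Bool) → Bool) → (k : ℕ) → (Vec A k → Bool) → Bool
allVec ∀A zero    f = f []
allVec ∀A (suc k) f = ∀A (λ x → allVec ∀A k (λ xs → f (x ∷ xs)))

anyVec : {A : Set} → ((A → Bool) → Bool) → (k : ℕ) → (Vec A k → Bool) → Bool
anyVec ∃A zero    f = f []
anyVec ∃A (suc k) f = ∃A (λ x → anyVec ∃A k (λ xs → f (x ∷ xs)))

allVec-sound : {A : Set} {∀A : (A → Bool) → Bool} → (∀ {g} → Bool.T (∀A g) → ∀ x → Bool.T (g x))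
  → ∀ k {f} → Bool.T (allVec ∀A k f) → ∀ xs → Bool.T (f xs)
allVec-sound ∀A-sound zero    t []       = t
allVec-sound ∀A-sound (suc k) t (x ∷ xs) = allVec-sound ∀A-sound k (∀A-sound t x) xs

anyVec-sound : {A : Set} {∃A : (A → Bool) → Bool} → (∀ {g} → Bool.T (∃A g) → ∃[ x ] Bool.T (g x))
  → ∀ k {f} → Bool.T (anyVec ∃A k f) → ∃[ xs ] Bool.T (f xs)
anyVec-sound ∃A-sound zero    t = [] , t
anyVec-sound ∃A-sound (suc k) t with x , tx ← ∃A-sound t with xs , txs ← anyVec-sound ∃A-sound k tx = x ∷ xs , txs

allBool anyBool : (Bool → Bool) → Bool
allBool g = g false ∧ g true
anyBool g = g false ∨ g true

allBool-sound : ∀ {g} → Bool.T (allBool g) → ∀ b → Bool.T (g b)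
allBool-sound t false = proj₁ (T-∧ .to t)
allBool-sound t true  = proj₂ (T-∧ .to t)

anyBool-sound : ∀ {g} → Bool.T (anyBool g) → ∃[ b ] Bool.T (g b)
anyBool-sound t = [ (false ,_) , (true ,_) ]′ (T-∨ .to t)

allGraphs : (m : ℕ) → (Graph m m → Bool) → Bool
allGraphs m = allVec (allVec allBool m) m

hasHallViolator : ∀ {m m′} → Graph m m′ → Bool
hasHallViolator {m} G = anyVec anyBool m (λ X → isHallViolator G (lookup X))

byExhaustion : ∀ {m} {P : Graph m m → Set} (P? : ∀ G → Dec (P G))
  → Bool.T (allGraphs m (λ G → hasHallViolator G ∨ ⌊ P? G ⌋)) → ∀ G → StrictHall G → P G
byExhaustion {m} P? t G hall with T-∨ .to (allVec-sound (allVec-sound allBool-sound m) m t G)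
... | inj₁ violated with X , tX ← anyVec-sound anyBool-sound m violated =
  contradiction (isHallViolator-sound G (lookup X) tX) (hall (lookup X))
... | inj₂ holds = toWitness holds

Complete : ∀ {m m′} → Graph m m′ → Set
Complete G = ∀ i j → edge G i j ≡ true

complete? : ∀ {m m′} (G : Graph m m′) → Dec (Complete G)
complete? G = all? λ i → all? λ j → edge G i j Bool.≟ true

Edge : ∀ {m} → Graph m m → Fin m ⊎ Fin m → Fin m ⊎ Fin m → Set
Edge G (inj₁ i) (inj₂ j) = edge G i j ≡ true
Edge G (inj₂ j) (inj₁ i) = edge G i j ≡ true
Edge G _        _        = ⊥

edge? : ∀ {m} (G : Graph m m) → Decidable (Edge G)
edge? G (inj₁ i) (inj₂ j) = edge G i j Bool.≟ true
edge? G (inj₂ j) (inj₁ i) = edge G i j Bool.≟ true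
edge? G (inj₁ _) (inj₁ _) = no λ ()
edge? G (inj₂ _) (inj₂ _) = no λ ()

HamiltonianCycle : ∀ {m} → Graph m m → Set
HamiltonianCycle {m} G = ∃[ c ] (IsCycle (Edge G) c × length c ≡ m + m)

insertions : {A : Set} → A → List A → List (List A)
insertions x []       = [ x ∷ [] ]
insertions x (y ∷ ys) = (x ∷ y ∷ ys) ∷ map (y ∷_) (insertions x ys)

permutations : {A : Set} → List A → List (List A)
permutations []       = [ [] ]
permutations (x ∷ xs) = concatMap (insertions x) (permutations xs)

alternate : {A B : Set} → List A → List B → List (A ⊎ B)
alternate (x ∷ xs) (y ∷ ys) = inj₁ x ∷ inj₂ y ∷ alternate xs ys
alternate _        _        = []

-- All Hamiltonian cycles of K_{m+1,m+1}, each read from left vertex 0.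
candidateCycles : (m : ℕ) → List (List (Fin (suc m) ⊎ Fin (suc m)))
candidateCycles m = cartesianProductWith (λ π σ → alternate (zero ∷ π) σ)
  (permutations (List.tabulate suc)) (permutations (allFin (suc m)))

closedWalk? : {A : Set} {E : A → A → Set} → Decidable E → ∀ c → Dec (ClosedWalk E c)
closedWalk? E? []       = no λ ()
closedWalk? E? (x ∷ xs) = linked? E? (x ∷ xs ++ [ x ])

WellFormedCycle : ℕ → {A : Set} → List A → Set
WellFormedCycle k c = Unique c × 3 ≤ length c × length c ≡ k

wellFormedCycle? : ∀ k {A : Set} → DecidableEquality A → (c : List A) → Dec (WellFormedCycle k c)
wellFormedCycle? k _≟ₐ_ c = DecUnique.unique? _≟ₐ_ c ×-dec 3 ℕ.≤? length c ×-dec length c ℕ.≟ k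

candidateCycles-wellFormed : ∀ m → True (All.all? (wellFormedCycle? (suc m + suc m) (≡-dec-⊎ _≟_ _≟_)) (candidateCycles m))
  → All (WellFormedCycle (suc m + suc m)) (candidateCycles m)
candidateCycles-wellFormed m = toWitness

HasCandidateCycle : ∀ {m} → Graph (suc m) (suc m) → Set
HasCandidateCycle {m} G = Any (ClosedWalk (Edge G)) (candidateCycles m)

hasCandidateCycle? : ∀ {m} (G : Graph (suc m) (suc m)) → Dec (HasCandidateCycle G)
hasCandidateCycle? {m} G = Any.any? (closedWalk? (edge? G)) (candidateCycles m)

candidate⇒hamiltonian : ∀ {m} (G : Graph (suc m) (suc m)) → All (WellFormedCycle (suc m + suc m)) (candidateCycles m)
  → HasCandidateCycle G → HamiltonianCycle G
candidate⇒hamiltonian G wf found with (c! , 3≤ , len) , walk ← lookupAny wf found = _ , (c! , 3≤ , walk) , len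

rowDegree : ∀ {m m′} → Graph m m′ → Fin m → ℕ
rowDegree G i = # edge G i

Claw : ∀ {m m′} → Graph m m′ → Set
Claw G = ∃[ j ] ∃[ a ] ∃[ b ] ∃[ c ] (a ≢ b × a ≢ c × b ≢ c
  × edge G a j ≡ true × edge G b j ≡ true × edge G c j ≡ true
  × rowDegree G a ≡ 2 × rowDegree G b ≡ 2 × rowDegree G c ≡ 2)

claw? : ∀ {m m′} (G : Graph m m′) → Dec (Claw G)
claw? G = any? λ j → any? λ a → any? λ b → any? λ c →
  ¬? (a ≟ b) ×-dec ¬? (a ≟ c) ×-dec ¬? (b ≟ c)
  ×-dec edge G a j Bool.≟ true ×-dec edge G b j Bool.≟ true ×-dec edge G c j Bool.≟ true
  ×-dec rowDegree G a ℕ.≟ 2 ×-dec rowDegree G b ℕ.≟ 2 ×-dec rowDegree G c ℕ.≟ 2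

allButFirst : ∀ {k} → Fin (suc k) → Bool
allButFirst zero    = false
allButFirst (suc _) = true

#allButFirst : ∀ k → # allButFirst {k} ≡ k
#allButFirst k =
  trans (cong length (filter-all (λ i → allButFirst {k} i Bool.≟ true) (All.tabulate⁺ {f = Fin.suc} λ _ → refl)))
        (length-tabulate {n = k} Fin.suc)

-- Otherwise all left vertices but the first form a Hall violator.
StrictHall⇒≤ : ∀ {m m′} (G : Graph m m′) → 2 ≤ m → StrictHall G → m ≤ m′
StrictHall⇒≤ {suc (suc k)} {m′} G (s≤s (s≤s z≤n)) hall with suc (suc k) ℕ.≤? m′
... | yes ≤m′ = ≤m′
... | no ≰m′ = contradiction violator (hall allButFirst)
  where
  violator : HallViolator G allButFirst
  violator = record
    { inhabited = suc zero , refl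
    ; proper    = inj₁ (zero , refl)
    ; deficient = begin
        # neighbourhood G allButFirst  ≤⟨ IndexCount.card≤length m′ _ (λ {j} _ → ∈-allFin j) ⟩
        length (allFin m′)             ≡⟨ length-tabulate id ⟩
        m′                             ≤⟨ ℕ.≤-pred (ℕ.≰⇒> ≰m′) ⟩
        suc k                          ≡⟨ sym (#allButFirst (suc k)) ⟩
        # allButFirst {suc k}          ∎
    }
    where open ℕ.≤-Reasoning

-- Each `_` below is solved by evaluating a Boolean check over all m × m graphs.
strictHall₂⇒complete : (G : Graph 2 2) → StrictHall G → Complete G
strictHall₂⇒complete = byExhaustion complete? _

strictHall₃⇒hamiltonian : (G : Graph 3 3) → StrictHall G → HamiltonianCycle G
strictHall₃⇒hamiltonian G hall =
  candidate⇒hamiltonian G (candidateCycles-wellFormed 2 _) (byExhaustion hasCandidateCycle? _ G hall)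

strictHall₄⇒hamiltonian⊎claw : (G : Graph 4 4) → StrictHall G → HamiltonianCycle G ⊎ Claw G
strictHall₄⇒hamiltonian⊎claw G hall =
  Sum.map₁ (candidate⇒hamiltonian G (candidateCycles-wellFormed 3 _))
           (byExhaustion (λ G → hasCandidateCycle? G ⊎-dec claw? G) _ G hall)

-- Minimal disconnected-halfway sets

-- Shaped like the summand of Defs.degree, so that degree F u is count (healthy F u) by definition.
healthy : ∀ {n} → EdgeSet n → V n → V n → Bool
healthy F u v = (if hamming u v ≡ᵇ 1 then true else false) ∧ not (mem F u v)

healthy⇒Healthy : ∀ {n} (F : EdgeSet n) {u v} → healthy F u v ≡ true → Healthy F u v
healthy⇒Healthy F {u} {v} h with hamming u v | mem F u v
... | 1           | false = refl , refl
... | 1           | true  = contradiction h λ ()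
... | zero        | _     = contradiction h λ ()
... | suc (suc _) | _     = contradiction h λ ()

Healthy⇒healthy : ∀ {n} (F : EdgeSet n) {u v} → Healthy F u v → healthy F u v ≡ true
Healthy⇒healthy F (adj , ok) rewrite adj | ok = refl

unhealthy⇒faulty : ∀ {n} (F : EdgeSet n) {u v} → healthy F u v ≡ false → Adj u v → mem F u v ≡ true
unhealthy⇒faulty F h adj = ¬-not λ ok → contradiction (trans (sym (Healthy⇒healthy F (adj , ok))) h) λ ()

does⇒witness : {A : Set} (a? : Dec A) → does a? ≡ true → A
does⇒witness (yes a) _ = a

DHW⇒cutOff : ∀ {n} {F : EdgeSet n} {S : VSet n} → DHW F S
  → ∃[ p ] (count (withParity (not p) S) ≤ count (withParity p S) × CutOff F S p)
DHW⇒cutOff (_ , inj₁ (majority , cut)) = false , majority , cut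
DHW⇒cutOff (_ , inj₂ (majority , cut)) = true , majority , cut

cutOff⇒DHW : ∀ {n} {F : EdgeSet n} {S : VSet n} p → ProperNonempty S
  → count (withParity (not p) S) ≤ count (withParity p S) → CutOff F S p → DHW F S
cutOff⇒DHW false nonempty majority cut = nonempty , inj₁ (majority , cut)
cutOff⇒DHW true  nonempty majority cut = nonempty , inj₂ (majority , cut)

_≟V_ : ∀ {n} (u v : V n) → Dec (u ≡ v)
_≟V_ = Vec.≡-dec Bool._≟_

IsCycle-map : ∀ {A B : Set} {E : A → A → Set} {E′ : B → B → Set} (f : A → B)
  → (∀ {x y} → f x ≡ f y → x ≡ y) → (∀ {x y} → E x y → E′ (f x) (f y))
  → ∀ {c} → IsCycle E c → IsCycle E′ (map f c)
IsCycle-map f f-injective f-edge {[]}     (_ , _ , ())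
IsCycle-map f f-injective f-edge {x ∷ xs} (unique , 3≤ , walk) =
  Unique.map⁺ f-injective unique ,
  subst (3 ≤_) (sym (length-map f (x ∷ xs))) 3≤ ,
  subst (Linked _) (cong (f x ∷_) (map-++ f xs [ x ])) (Linked.map⁺ (Linked.map f-edge walk))

Healthy-sym : ∀ {n} (F : EdgeSet n) {u v} → Healthy F u v → Healthy F v u
Healthy-sym F {u} {v} (adj , ok) = Adj-sym {u = u} adj , trans (EdgeSet.sym F v u) ok

double-injective : ∀ {a b} → a + a ≡ b + b → a ≡ b
double-injective {a} {b} e = trans (ℕ.n≡⌊n+n/2⌋ a) (trans (cong ⌊_/2⌋ e) (sym (ℕ.n≡⌊n+n/2⌋ b)))

module MinimalTrap {n} (F : EdgeSet n) (T : VSet n) (p : Bool) (cut : CutOff F T p)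
  (minimal : ∀ S → S ⊂V T → ¬ DHW F S) where

  module Classes {m m′} (A : Enumeration (withParity p T) m) (B : Enumeration (withParity (not p) T) m′) where

    open Enumeration A public using () renaming
      (element to α; element-injective to α-injective; element-sound to α-sound; element-complete to α-complete)
    open Enumeration B public using () renaming
      (element to β; element-injective to β-injective; element-sound to β-sound; element-complete to β-complete)

    α∈T : ∀ i → T (α i) ≡ true
    α∈T i = ∧-conicalˡ _ _ (α-sound i)

    α-parity : ∀ i → parity (α i) ≡ p
    α-parity i = hasParity⁻ {v = α i} (∧-conicalʳ _ _ (α-sound i))

    β∈T : ∀ j → T (β j) ≡ true
    β∈T j = ∧-conicalˡ _ _ (β-sound j)

    β-parity : ∀ j → parity (β j) ≡ not p
    β-parity j = hasParity⁻ {v = β j} (∧-conicalʳ _ _ (β-sound j))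

    α≢β : ∀ {i j} → α i ≢ β j
    α≢β {i} {j} e = not-¬ refl (trans (sym (α-parity i)) (trans (cong parity e) (β-parity j)))

    α-class : ∀ {v} → T v ≡ true → parity v ≡ p → ∃[ i ] α i ≡ v
    α-class {v} Tv pv = α-complete (cong₂ _∧_ Tv (hasParity⁺ {v = v} pv))

    β-class : ∀ {v} → T v ≡ true → parity v ≡ not p → ∃[ j ] β j ≡ v
    β-class {v} Tv pv = β-complete (cong₂ _∧_ Tv (hasParity⁺ {v = v} pv))

    neighbour-parity : ∀ i {v} → Adj (α i) v → parity v ≡ not p
    neighbour-parity i {v} adj = trans (Adj⇒parity≢ {u = v} (Adj-sym {u = α i} adj)) (cong not (α-parity i))

    healthy-neighbour : ∀ i {v} → Healthy F (α i) v → ∃[ j ] β j ≡ v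
    healthy-neighbour i {v} (adj , ok) with T v in Tv
    ... | true  = β-class Tv (neighbour-parity i adj)
    ... | false = contradiction (trans (sym (cut (α i) v (α∈T i) (α-parity i) Tv adj)) ok) λ ()

    healthyGraph : Graph m m′
    healthyGraph = tabulate λ i → tabulate λ j → healthy F (α i) (β j)

    edge-healthyGraph : ∀ i j → edge healthyGraph i j ≡ healthy F (α i) (β j)
    edge-healthyGraph i j = trans (cong (λ row → lookup row j) (lookup∘tabulate _ i)) (lookup∘tabulate _ j)

    degree-α : ∀ i → degree F (α i) ≡ rowDegree healthyGraph i
    degree-α i = card-reindex (allV-unique n) (allV-complete n) β β-injective _ _
      (λ j → sym (edge-healthyGraph i j)) (healthy-neighbour i ∘ healthy⇒Healthy F)

    module HallSet (X : Fin m → Bool) where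

      N : Fin m′ → Bool
      N = neighbourhood healthyGraph X

      Member : V n → Set
      Member v = (∃[ i ] X i ≡ true × α i ≡ v) ⊎ (∃[ j ] N j ≡ true × β j ≡ v)

      member? : ∀ v → Dec (Member v)
      member? v = any? (λ i → (X i Bool.≟ true) ×-dec (α i ≟V v))
            ⊎-dec any? (λ j → (N j Bool.≟ true) ×-dec (β j ≟V v))

      S : VSet n
      S v = does (member? v)

      S-member : ∀ {v} → S v ≡ true → Member v
      S-member {v} = does⇒witness (member? v)

      S-α : ∀ i → S (α i) ≡ X i
      S-α i with X i in Xi
      ... | true  = dec-true (member? (α i)) (inj₁ (i , Xi , refl))
      ... | false = dec-false (member? (α i)) not-member
        where
        not-member : ¬ Member (α i)
        not-member (inj₁ (i′ , Xi′ , e)) with refl ← α-injective e = contradiction (trans (sym Xi′) Xi) λ ()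
        not-member (inj₂ (j , _ , e))    = α≢β (sym e)

      S-β : ∀ j → S (β j) ≡ N j
      S-β j with N j in Nj
      ... | true  = dec-true (member? (β j)) (inj₂ (j , Nj , refl))
      ... | false = dec-false (member? (β j)) not-member
        where
        not-member : ¬ Member (β j)
        not-member (inj₁ (i , _ , e))    = α≢β e
        not-member (inj₂ (j′ , Nj′ , e)) with refl ← β-injective e = contradiction (trans (sym Nj′) Nj) λ ()

      S⊆T : ∀ v → S v ≡ true → T v ≡ true
      S⊆T _ Sv with S-member Sv
      ... | inj₁ (i , _ , refl) = α∈T i
      ... | inj₂ (j , _ , refl) = β∈T j

      count-S-p : count (withParity p S) ≡ # X
      count-S-p = card-reindex (allV-unique n) (allV-complete n) α α-injective _ _
        (λ i → trans (cong₂ _∧_ (S-α i) (hasParity⁺ {v = α i} (α-parity i))) (∧-identityʳ (X i))) onA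
        where
        onA : ∀ {v} → withParity p S v ≡ true → ∃[ i ] α i ≡ v
        onA Sv with S-member (∧-conicalˡ _ _ Sv)
        ... | inj₁ (i , _ , e) = i , e
        ... | inj₂ (j , _ , refl) =
          contradiction (trans (sym (hasParity⁻ {v = β j} (∧-conicalʳ _ _ Sv))) (β-parity j)) (not-¬ refl)

      count-S-¬p : count (withParity (not p) S) ≡ # N
      count-S-¬p = card-reindex (allV-unique n) (allV-complete n) β β-injective _ _
        (λ j → trans (cong₂ _∧_ (S-β j) (hasParity⁺ {v = β j} (β-parity j))) (∧-identityʳ (N j))) onB
        where
        onB : ∀ {v} → withParity (not p) S v ≡ true → ∃[ j ] β j ≡ v
        onB Sv with S-member (∧-conicalˡ _ _ Sv)
        ... | inj₂ (j , _ , e) = j , e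
        ... | inj₁ (i , _ , refl) =
          contradiction (trans (sym (α-parity i)) (hasParity⁻ {v = α i} (∧-conicalʳ _ _ Sv))) (not-¬ refl)

      S-cutOff : CutOff F S p
      S-cutOff u v Su pu Sv adj with S-member Su
      ... | inj₂ (j , _ , refl) = contradiction (trans (sym pu) (β-parity j)) (not-¬ refl)
      ... | inj₁ (i , Xi , refl) with T v in Tv
      ...   | false = cut (α i) v (α∈T i) pu Tv adj
      ...   | true with j , refl ← β-class Tv (neighbour-parity i adj) =
        unhealthy⇒faulty F (trans (sym (edge-healthyGraph i j)) non-edge) adj
        where
        non-edge : edge healthyGraph i j ≡ false
        non-edge with edge healthyGraph i j in e
        ... | false = refl
        ... | true  = contradiction (trans (sym (∈-neighbourhood healthyGraph Xi e)) (trans (sym (S-β j)) Sv)) λ ()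

    strictHall : StrictHall healthyGraph
    strictHall X violator =
      minimal S (inhabitant , S⊆T , missing) (cutOff⇒DHW {F = F} {S = S} p (inhabitant , missing′) majority S-cutOff)
      where
      open HallSet X
      open HallViolator violator
      inhabitant : ∃[ v ] S v ≡ true
      inhabitant with i , Xi ← inhabited = α i , trans (S-α i) Xi
      missing : ∃[ v ] (T v ≡ true × S v ≡ false)
      missing with proper
      ... | inj₁ (i , Xi) = α i , α∈T i , trans (S-α i) Xi
      ... | inj₂ (j , Nj) = β j , β∈T j , trans (S-β j) Nj
      missing′ : ∃[ v ] S v ≡ false
      missing′ = Product.map₂ proj₂ missing
      majority : count (withParity (not p) S) ≤ count (withParity p S)
      majority = subst₂ _≤_ (sym count-S-¬p) (sym count-S-p) deficient

    classes-≤ : 2 ≤ m → m ≤ m′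
    classes-≤ 2≤m = StrictHall⇒≤ healthyGraph 2≤m strictHall

  module BalancedClasses {m} (A : Enumeration (withParity p T) m) (B : Enumeration (withParity (not p) T) m) where
    open Classes A B

    vertex : Fin m ⊎ Fin m → V n
    vertex = [ α , β ]′

    vertex∈T : ∀ x → T (vertex x) ≡ true
    vertex∈T (inj₁ i) = α∈T i
    vertex∈T (inj₂ j) = β∈T j

    vertex-injective : ∀ {x y} → vertex x ≡ vertex y → x ≡ y
    vertex-injective {inj₁ i} {inj₁ i′} e = cong inj₁ (α-injective e)
    vertex-injective {inj₂ j} {inj₂ j′} e = cong inj₂ (β-injective e)
    vertex-injective {inj₁ i} {inj₂ j}  e = contradiction e α≢β
    vertex-injective {inj₂ j} {inj₁ i}  e = contradiction (sym e) α≢β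

    edge⇒Healthy : ∀ {i j} → edge healthyGraph i j ≡ true → Healthy F (α i) (β j)
    edge⇒Healthy {i} {j} e = healthy⇒Healthy F (trans (sym (edge-healthyGraph i j)) e)

    Edge⇒Adj : ∀ {x y} → Edge healthyGraph x y → Adj (vertex x) (vertex y)
    Edge⇒Adj {inj₁ i} {inj₂ j} e = proj₁ (edge⇒Healthy e)
    Edge⇒Adj {inj₂ j} {inj₁ i} e = proj₁ (Healthy-sym F (edge⇒Healthy e))

    hamiltonian⇒InducedCycle : HamiltonianCycle healthyGraph → InducedCycle T (m + m)
    hamiltonian⇒InducedCycle (c , cycle , length≡) =
      map vertex c , IsCycle-map vertex vertex-injective Edge⇒Adj cycle ,
      trans (length-map vertex c) length≡ , All.map⁺ (All.universal vertex∈T c)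

    claw⇒CLTrap : Claw healthyGraph → CLTrap F
    claw⇒CLTrap (j , a , b , c , a≢b , a≢c , b≢c , aj , bj , cj , deg-a , deg-b , deg-c) =
      β j , α a , α b , α c , a≢b ∘ α-injective , a≢c ∘ α-injective , b≢c ∘ α-injective ,
      Healthy-sym F (edge⇒Healthy aj) , Healthy-sym F (edge⇒Healthy bj) , Healthy-sym F (edge⇒Healthy cj) ,
      trans (degree-α a) deg-a , trans (degree-α b) deg-b , trans (degree-α c) deg-c

  complete⇒IsQ2 : (A : Enumeration (withParity p T) 2) (B : Enumeration (withParity (not p) T) 2)
    → Complete (Classes.healthyGraph A B) → IsQ2 T
  complete⇒IsQ2 A B complete =
    four-cycle⇒IsQ2 T (λ e → contradiction (β-injective e) λ ()) (λ e → contradiction (α-injective e) λ ())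
      (adj zero zero) (adj zero (suc zero))
      (Adj-sym {u = α (suc zero)} (adj (suc zero) zero)) (Adj-sym {u = α (suc zero)} (adj (suc zero) (suc zero)))
      λ v → mk⇔ corner (member v)
    where
    open Classes A B
    open BalancedClasses A B using (edge⇒Healthy)
    adj : ∀ i j → Adj (α i) (β j)
    adj i j = proj₁ (edge⇒Healthy (complete i j))
    corner : ∀ {v} → T v ≡ true → v ≡ α zero ⊎ v ≡ β zero ⊎ v ≡ β (suc zero) ⊎ v ≡ α (suc zero)
    corner {v} Tv with parity v Bool.≟ p
    ... | yes pv with α-class Tv pv
    ...   | zero , refl     = inj₁ refl
    ...   | suc zero , refl = inj₂ (inj₂ (inj₂ refl))
    corner {v} Tv | no ¬pv with β-class Tv (¬-not ¬pv)
    ...   | zero , refl     = inj₂ (inj₁ refl)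
    ...   | suc zero , refl = inj₂ (inj₂ (inj₁ refl))
    member : ∀ v → v ≡ α zero ⊎ v ≡ β zero ⊎ v ≡ β (suc zero) ⊎ v ≡ α (suc zero) → T v ≡ true
    member _ (inj₁ refl)               = α∈T zero
    member _ (inj₂ (inj₁ refl))        = β∈T zero
    member _ (inj₂ (inj₂ (inj₁ refl))) = β∈T (suc zero)
    member _ (inj₂ (inj₂ (inj₂ refl))) = α∈T (suc zero)

  balancedClasses : count (withParity (not p) T) ≤ count (withParity p T) → ∀ h → 2 ≤ h → size T ≡ h + h
    → Enumeration (withParity p T) h × Enumeration (withParity (not p) T) h
  balancedClasses majority h 2≤h size≡ = subst (Enumeration _) a≡h A , subst (Enumeration _) (trans (sym a≡b) a≡h) B
    where
    a b : ℕ
    a = count (withParity p T)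
    b = count (withParity (not p) T)
    A : Enumeration (withParity p T) a
    A = VertexCount.enumerate n (withParity p T)
    B : Enumeration (withParity (not p) T) b
    B = VertexCount.enumerate n (withParity (not p) T)
    a+b≡h+h : a + b ≡ h + h
    a+b≡h+h = trans (sym (size-split p T)) size≡
    2≤a : 2 ≤ a
    2≤a with 2 ℕ.≤? a
    ... | yes 2≤a = 2≤a
    ... | no 2≰a = contradiction (begin
            4      ≤⟨ ℕ.+-mono-≤ 2≤h 2≤h ⟩
            h + h  ≡⟨ sym a+b≡h+h ⟩
            a + b  ≤⟨ ℕ.+-mono-≤ a≤1 (ℕ.≤-trans majority a≤1) ⟩
            2      ∎) λ { (s≤s (s≤s ())) }
      where
      open ℕ.≤-Reasoning
      a≤1 : a ≤ 1
      a≤1 = ℕ.≤-pred (ℕ.≰⇒> 2≰a)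
    a≡b : a ≡ b
    a≡b = ℕ.≤-antisym (Classes.classes-≤ A B 2≤a) majority
    a≡h : a ≡ h
    a≡h = double-injective (trans (cong (a +_) a≡b) a+b≡h+h)

lemma5 : (n : ℕ) → 3 ≤ n → (F : EdgeSet n) → Minimal F → (T : VSet n) → DHW F T
       → (∀ (S : VSet n) → S ⊂V T → ¬ DHW F S)
       → (size T ≡ 4 → Q2DHWTrap F T)
       × (size T ≡ 6 → InducedCycle T 6)
       × (size T ≡ 8 → InducedCycle T 8 ⊎ CLTrap F)
lemma5 n _ F _ T dhw minimal with p , majority , cut ← DHW⇒cutOff {F = F} {S = T} dhw = square , hexagon , octagon
  where
  open MinimalTrap F T p cut minimal
  open Classes
  open BalancedClasses
  square : size T ≡ 4 → Q2DHWTrap F T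
  square size≡ with A , B ← balancedClasses majority 2 (s≤s (s≤s z≤n)) size≡ =
    complete⇒IsQ2 A B (strictHall₂⇒complete _ (strictHall A B)) , dhw
  hexagon : size T ≡ 6 → InducedCycle T 6
  hexagon size≡ with A , B ← balancedClasses majority 3 (s≤s (s≤s z≤n)) size≡ =
    hamiltonian⇒InducedCycle A B (strictHall₃⇒hamiltonian _ (strictHall A B))
  octagon : size T ≡ 8 → InducedCycle T 8 ⊎ CLTrap F
  octagon size≡ with A , B ← balancedClasses majority 4 (s≤s (s≤s z≤n)) size≡ =
    Sum.map (hamiltonian⇒InducedCycle A B) (claw⇒CLTrap A B) (strictHall₄⇒hamiltonian⊎claw _ (strictHall A B))
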